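{- Let $k\geq 4$ and let $a$ and $a'$ be binary sequences of length $k$. If $a\odot M_I(k)^*$ and $a'\odot M_I(k)^*$ represent the same configuration, then $a'$ equals $a$ up to shifts and reversals.
   Context: For $k\geq3$, $M_I(k)$ is the $k\times k$ binary matrix whose row $i<k$ has ones exactly in columns $i,i+1$ and whose row $k$ has ones exactly in columns $1,k$; $M^*$ is $M$ with a last all-zero column appended. For $a=a_1\dots a_k$, $a\odot M$ complements each row $i$ of $M$ with $a_i=1$. Two matrices represent the same configuration if they are equal up to permutations of rows and of columns. The shift of $a_1a_2\dots a_k$ is $a_2\dots a_ka_1$ and its reversal is $a_k\dots a_1$; "equal up to shifts and reversals" means obtainable by repeatedly applying these operations. -}

module Defs where

open import Data.Nat using (ℕ; zero; suc; _+_)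
open import Data.Bool using (Bool; true; false; not; if_then_else_; _∧_; _∨_)
open import Data.Fin using (Fin; zero; suc; toℕ; inject₁; fromℕ)
open import Data.Nat.Base using (_≡ᵇ_)
open import Data.Product using (Σ; _×_; _,_)
open import Function.Bundles using (_↔_; Inverse)
open import Relation.Binary.PropositionalEquality using (_≡_)
open import Relation.Binary.Construct.Closure.ReflexiveTransitive using (Star)

Matrix : ℕ → ℕ → Set
Matrix m n = Fin m → Fin n → Bool

Seq : ℕ → Set
Seq k = Fin k → Bool

-- M_I(k), with rows/columns indexed 0 .. k-1:
-- row i < k-1 has ones exactly in columns i, i+1;
-- row k-1 has ones exactly in columns 0, k-1.
-- (Paper's row i corresponds to index i-1 here.)
M-I : (k : ℕ) → Matrix k k
M-I k i j =
  if suc (toℕ i) ≡ᵇ k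
  then ((toℕ j ≡ᵇ 0) ∨ (suc (toℕ j) ≡ᵇ k))
  else ((toℕ j ≡ᵇ toℕ i) ∨ (toℕ j ≡ᵇ suc (toℕ i)))

-- M* : M with a last all-zero column appended.
star : ∀ {m n} → Matrix m n → Matrix m (suc n)
star {n = zero}  M i zero    = false
star {n = suc n} M i zero    = M i zero
star {n = suc n} M i (suc j) = star (λ i' j' → M i' (suc j')) i j

_⊙_ : ∀ {m n} → Seq m → Matrix m n → Matrix m n
(a ⊙ M) i j = if a i then not (M i j) else M i j

SameConfig : ∀ {m n} → Matrix m n → Matrix m n → Set
SameConfig {m} {n} A B =
  Σ (Fin m ↔ Fin m) λ σ → Σ (Fin n ↔ Fin n) λ τ →
    ∀ i j → A (Inverse.to σ i) (Inverse.to τ j) ≡ B i j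

-- cyclic successor on Fin (suc k): j ↦ j+1, and k ↦ 0
next : ∀ {k} → Fin (suc k) → Fin (suc k)
next {zero}  zero    = zero
next {suc k} zero    = suc zero
next {suc k} (suc j) with next j
... | zero   = zero
... | suc j' = suc (suc j')

shift : ∀ {k} → Seq k → Seq k
shift {zero}  a ()
shift {suc k} a i = a (next i)

reverse : ∀ {k} → Seq k → Seq k
reverse a i = a (Data.Fin.opposite i)

data Step {k : ℕ} : Seq k → Seq k → Set where
  by-shift   : ∀ a → Step a (shift a)
  by-reverse : ∀ a → Step a (reverse a)

UpToShiftRev : ∀ {k} → Seq k → Seq k → Set
UpToShiftRev {k} a a' = Σ (Seq k) λ b → Star Step a b × (∀ i → b i ≡ a' i)

-- Row i of M_I(k)* has its ones in the columns i and i + 1 only, so in row i of a ⊙ M_I(k)*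
-- the value not a_i occurs twice and a_i occurs k - 1 ≥ 3 times. Hence the row and column
-- permutations relating the two configurations match rows with equal bits and form an
-- automorphism of M_I(k)*. Two rows share a column exactly when they are adjacent on the
-- k-cycle, so the row permutation is an automorphism of the cycle: a rotation, possibly
-- composed with a reflection, and these turn a into a' by shifts and at most one reversal.
module Submission where

open import Defs
open import Data.Bool using (Bool; true; false; not; _∨_)
open import Data.Bool.Properties using (T-≡; ∨-comm; ¬-not; not-injective)
  renaming (_≟_ to _≟ᴮ_)
open import Data.Empty using (⊥-elim)
open import Data.Fin using (Fin; zero; suc; toℕ; inject₁; fromℕ; opposite)
open import Data.Fin.Properties
  using (toℕ-injective; toℕ<n; opposite-prop; opposite-involutive;
         inject₁-injective; fromℕ≢inject₁; injective⇒≤)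
open import Data.Fin.Relation.Unary.Top using (view; ‵fromℕ; ‵inj₁)
open import Data.Nat using (ℕ; zero; suc; _+_; _≤_; _<_; _≥_; _∸_; _≡ᵇ_; s≤s; z≤n)
open import Data.Nat.GeneralisedArithmetic using (fold; fold-+)
open import Data.Nat.Properties as ℕ
  using (≡ᵇ⇒≡; ≡⇒≡ᵇ; 1+n≢n; <⇒≢; ≤-trans; ≤-pred; n≤1+n; +-comm)
open import Data.Product using (∃; ∃₂; _×_; _,_; proj₁; proj₂)
open import Data.Sum as Sum using (_⊎_; inj₁; inj₂; [_,_]; [_,_]′)
open import Function using (_∘_; id; _↔_; _⇔_; Inverse; Injection; Equivalence; mk⇔)
open import Function.Definitions using (Injective)
open import Function.Properties.Inverse using (↔⇒↣)
open import Relation.Binary.Construct.Closure.ReflexiveTransitive using (Star; ε; _◅_; _◅◅_)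
open import Relation.Binary.PropositionalEquality
  using (_≡_; _≢_; refl; sym; trans; cong; subst; module ≡-Reasoning)
open import Relation.Nullary using (yes; no; contradiction)

private variable
  n : ℕ

toℕ-next : (x : Fin (suc n)) →
  (toℕ x ≡ n × next x ≡ zero) ⊎ (toℕ x < n × toℕ (next x) ≡ suc (toℕ x))
toℕ-next {zero}  zero    = inj₁ (refl , refl)
toℕ-next {suc n} zero    = inj₂ (s≤s z≤n , refl)
toℕ-next {suc n} (suc x) with next x | toℕ-next x
... | zero   | inj₁ (x≡n , _) = inj₁ (cong suc x≡n , refl)
... | suc y  | inj₂ (x<n , y≡1+x) = inj₂ (s≤s x<n , cong suc y≡1+x)

next-injective : Injective _≡_ _≡_ (next {n})
next-injective {x = x} {y} eq with toℕ-next x | toℕ-next y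
... | inj₁ (x≡n , _) | inj₁ (y≡n , _) = toℕ-injective (trans x≡n (sym y≡n))
... | inj₁ (_ , x↦0) | inj₂ (_ , y↦) = contradiction (trans (sym y↦) (cong toℕ (trans (sym eq) x↦0))) λ ()
... | inj₂ (_ , x↦) | inj₁ (_ , y↦0) = contradiction (trans (sym x↦) (cong toℕ (trans eq y↦0))) λ ()
... | inj₂ (_ , x↦) | inj₂ (_ , y↦) = toℕ-injective (ℕ.suc-injective (trans (sym x↦) (trans (cong toℕ eq) y↦)))

next-x≢x : 1 ≤ n → (x : Fin (suc n)) → next x ≢ x
next-x≢x 1≤n x eq with toℕ-next x
... | inj₁ (x≡n , x↦0) = <⇒≢ 1≤n (trans (cong toℕ (trans (sym x↦0) eq)) x≡n)
... | inj₂ (_ , x↦)    = 1+n≢n (trans (sym x↦) (cong toℕ eq))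

next²-x≢x : 2 ≤ n → (x : Fin (suc n)) → next (next x) ≢ x
next²-x≢x 2≤n x eq with toℕ-next x | toℕ-next (next x)
... | inj₁ (x≡n , x↦0) | inj₁ (x'≡n , _) =
  <⇒≢ (≤-trans (s≤s z≤n) 2≤n) (trans (cong toℕ (sym x↦0)) x'≡n)
... | inj₁ (x≡n , x↦0) | inj₂ (_ , x'↦) =
  <⇒≢ 2≤n (trans (cong (suc ∘ toℕ) (sym x↦0)) (trans (sym x'↦) (trans (cong toℕ eq) x≡n)))
... | inj₂ (_ , x↦) | inj₁ (x'≡n , x'↦0) =
  <⇒≢ 2≤n (trans (cong (suc ∘ toℕ) (trans (sym x'↦0) eq)) (trans (sym x↦) x'≡n))
... | inj₂ (_ , x↦) | inj₂ (_ , x'↦) =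
  <⇒≢ (ℕ.m<n⇒m<1+n (ℕ.n<1+n (toℕ x))) (trans (cong toℕ (sym eq)) (trans x'↦ (cong suc x↦)))

next-fromℕ : next (fromℕ n) ≡ zero
next-fromℕ {zero}  = refl
next-fromℕ {suc n} rewrite next-fromℕ {n} = refl

next-opposite : (x : Fin (suc n)) → next (opposite (next x)) ≡ opposite x
next-opposite {n} x with toℕ-next x
... | inj₁ (x≡n , x↦0) = begin
  next (opposite (next x)) ≡⟨ cong (next ∘ opposite) x↦0 ⟩
  next (fromℕ n)           ≡⟨ next-fromℕ ⟩
  zero                     ≡⟨ toℕ-injective (sym (trans (opposite-prop x) (trans (cong (n ∸_) x≡n) (ℕ.n∸n≡0 n)))) ⟩
  opposite x               ∎
  where open ≡-Reasoning
... | inj₂ (x<n , x↦) with toℕ-next (opposite (next x))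
...   | inj₁ (x'≡n , _) = contradiction (trans (sym x'≡n) (trans (opposite-prop (next x)) (cong (n ∸_) x↦)))
                             (<⇒≢ (ℕ.∸-monoʳ-< {n} {suc (toℕ x)} {0} (s≤s z≤n) x<n) ∘ sym)
...   | inj₂ (_ , x'↦) = toℕ-injective (begin
  toℕ (next (opposite (next x))) ≡⟨ x'↦ ⟩
  suc (toℕ (opposite (next x)))  ≡⟨ cong suc (trans (opposite-prop (next x)) (cong (n ∸_) x↦)) ⟩
  suc (n ∸ suc (toℕ x))          ≡⟨ ℕ.+-∸-assoc 1 x<n ⟨
  n ∸ toℕ x                      ≡⟨ opposite-prop x ⟨
  toℕ (opposite x)               ∎)
  where open ≡-Reasoning

toℕ-fold-next : ∀ m → m ≤ n → toℕ (fold zero (next {n}) m) ≡ m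
toℕ-fold-next zero _ = refl
toℕ-fold-next (suc m) m<n with toℕ-next (fold zero next m) | toℕ-fold-next m (≤-trans (n≤1+n m) m<n)
... | inj₁ (≡n , _) | ih = contradiction (trans (sym ih) ≡n) (<⇒≢ m<n)
... | inj₂ (_ , ↦)  | ih = trans ↦ (cong suc ih)

fold-next-toℕ : (i : Fin (suc n)) → fold zero next (toℕ i) ≡ i
fold-next-toℕ i = toℕ-injective (toℕ-fold-next (toℕ i) (≤-pred (toℕ<n i)))

orbit-induction : (P : Fin (suc n) → Set) → P zero → (∀ i → P i → P (next i)) → ∀ i → P i
orbit-induction P P0 step i = subst P (fold-next-toℕ i) (along (toℕ i))
  where
  along : ∀ m → P (fold zero next m)
  along zero    = P0
  along (suc m) = step _ (along m)

fold-commute : ∀ {a} {A : Set a} (f g : A → A) → (∀ x → f (g x) ≡ g (f x)) →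
  ∀ z m → f (fold z g m) ≡ fold (f z) g m
fold-commute f g comm z zero    = refl
fold-commute f g comm z (suc m) = trans (comm _) (cong g (fold-commute f g comm z m))

fold-fold : ∀ {a} {A : Set a} (s : A → A) z m r → fold (fold z s r) s m ≡ fold (fold z s m) s r
fold-fold s z m r = begin
  fold (fold z s r) s m ≡⟨ fold-+ z s m ⟨
  fold z s (m + r)      ≡⟨ cong (fold z s) (+-comm m r) ⟩
  fold z s (r + m)      ≡⟨ fold-+ z s r ⟩
  fold (fold z s m) s r ∎
  where open ≡-Reasoning

commute-next⇒rotation : (ρ : Fin (suc n) → Fin (suc n)) → (∀ i → ρ (next i) ≡ next (ρ i)) →
  ∀ i → ρ i ≡ fold i next (toℕ (ρ zero))
commute-next⇒rotation ρ comm i = begin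
  ρ i                                       ≡⟨ cong ρ (fold-next-toℕ i) ⟨
  ρ (fold zero next (toℕ i))                ≡⟨ fold-commute ρ next comm zero (toℕ i) ⟩
  fold (ρ zero) next (toℕ i)                ≡⟨ cong (λ z → fold z next (toℕ i)) (fold-next-toℕ (ρ zero)) ⟨
  fold (fold zero next r) next (toℕ i)      ≡⟨ fold-fold next zero (toℕ i) r ⟩
  fold (fold zero next (toℕ i)) next r      ≡⟨ cong (λ z → fold z next r) (fold-next-toℕ i) ⟩
  fold i next r                             ∎
  where
  open ≡-Reasoning
  r : ℕ
  r = toℕ (ρ zero)

fold-shift : (c : Seq (suc n)) → ∀ r i → fold c shift r i ≡ c (fold i next r)
fold-shift c zero    i = refl
fold-shift c (suc r) i = trans (fold-shift c r (next i)) (cong c (sym (fold-commute next next (λ _ → refl) i r)))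

shifts-reachable : ∀ {k} (c : Seq k) r → Star Step c (fold c shift r)
shifts-reachable c zero    = ε
shifts-reachable c (suc r) = shifts-reachable c r ◅◅ (by-shift _ ◅ ε)

rotation⇒UpToShiftRev : {a a' : Seq (suc n)} (ρ : Fin (suc n) → Fin (suc n)) →
  (∀ i → ρ (next i) ≡ next (ρ i)) → (∀ i → a (ρ i) ≡ a' i) → UpToShiftRev a a'
rotation⇒UpToShiftRev {a = a} {a'} ρ comm a∘ρ≡a' = fold a shift r , shifts-reachable a r , λ i → begin
  fold a shift r i  ≡⟨ fold-shift a r i ⟩
  a (fold i next r) ≡⟨ cong a (commute-next⇒rotation ρ comm i) ⟨
  a (ρ i)           ≡⟨ a∘ρ≡a' i ⟩
  a' i              ∎
  where
  open ≡-Reasoning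
  r : ℕ
  r = toℕ (ρ zero)

reflection⇒UpToShiftRev : {a a' : Seq (suc n)} (ρ : Fin (suc n) → Fin (suc n)) →
  (∀ i → ρ i ≡ next (ρ (next i))) → (∀ i → a (ρ i) ≡ a' i) → UpToShiftRev a a'
reflection⇒UpToShiftRev {a = a} {a'} ρ anti a∘ρ≡a' =
  let b , steps , b≡a' = rotation⇒UpToShiftRev (opposite ∘ ρ) comm reverse-a∘ρ≡a'
  in  b , by-reverse a ◅ steps , b≡a'
  where
  comm : ∀ i → opposite (ρ (next i)) ≡ next (opposite (ρ i))
  comm i = sym (trans (cong (next ∘ opposite) (anti i)) (next-opposite (ρ (next i))))
  reverse-a∘ρ≡a' : ∀ i → reverse a (opposite (ρ i)) ≡ a' i
  reverse-a∘ρ≡a' i = trans (cong a (opposite-involutive (ρ i))) (a∘ρ≡a' i)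

-- A change of direction at i would give ρ i ≡ ρ (next (next i)), which injectivity forbids.
orientation : 2 ≤ n → (ρ : Fin (suc n) → Fin (suc n)) → Injective _≡_ _≡_ ρ →
  (∀ i → ρ (next i) ≡ next (ρ i) ⊎ ρ i ≡ next (ρ (next i))) →
  (∀ i → ρ (next i) ≡ next (ρ i)) ⊎ (∀ i → ρ i ≡ next (ρ (next i)))
orientation 2≤n ρ ρ-inj adjacent with adjacent zero
... | inj₁ forward0  = inj₁ (orbit-induction _ forward0 forward)
  where
  forward : ∀ i → ρ (next i) ≡ next (ρ i) → ρ (next (next i)) ≡ next (ρ (next i))
  forward i fwd with adjacent (next i)
  ... | inj₁ fwd' = fwd'
  ... | inj₂ bwd' = contradiction (ρ-inj (next-injective (trans (sym fwd) bwd'))) (next²-x≢x 2≤n i ∘ sym)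
... | inj₂ backward0 = inj₂ (orbit-induction _ backward0 backward)
  where
  backward : ∀ i → ρ i ≡ next (ρ (next i)) → ρ (next i) ≡ next (ρ (next (next i)))
  backward i bwd with adjacent (next i)
  ... | inj₂ bwd' = bwd'
  ... | inj₁ fwd' = contradiction (ρ-inj (trans fwd' (sym bwd))) (next²-x≢x 2≤n i)

star-inject₁ : ∀ {m n} (M : Matrix m n) i j → star M i (inject₁ j) ≡ M i j
star-inject₁ {n = suc n} M i zero    = refl
star-inject₁ {n = suc n} M i (suc j) = star-inject₁ (λ i' j' → M i' (suc j')) i j

star-fromℕ : ∀ {m n} (M : Matrix m n) i → star M i (fromℕ n) ≡ false
star-fromℕ {n = zero}  M i = refl
star-fromℕ {n = suc n} M i = star-fromℕ (λ i' j' → M i' (suc j')) i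

≡ᵇ-true⇔ : ∀ {m n} → (m ≡ᵇ n) ≡ true ⇔ m ≡ n
≡ᵇ-true⇔ {m} {n} = mk⇔ (≡ᵇ⇒≡ m n ∘ Equivalence.from T-≡) (Equivalence.to T-≡ ∘ ≡⇒≡ᵇ m n)

≡ᵇ-false : ∀ {m n} → m ≢ n → (m ≡ᵇ n) ≡ false
≡ᵇ-false {m} {n} m≢n with m ≡ᵇ n in eq
... | true  = contradiction (Equivalence.to ≡ᵇ-true⇔ eq) m≢n
... | false = refl

∨-true⇔ : ∀ {x y} {P Q : Set} → x ≡ true ⇔ P → y ≡ true ⇔ Q → (x ∨ y) ≡ true ⇔ (P ⊎ Q)
∨-true⇔ {true}  x⇔P y⇔Q = mk⇔ (λ _ → inj₁ (Equivalence.to x⇔P refl)) (λ _ → refl)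
∨-true⇔ {false} x⇔P y⇔Q =
  mk⇔ (inj₂ ∘ Equivalence.to y⇔Q) [ (λ p → contradiction (Equivalence.from x⇔P p) λ ()) , Equivalence.from y⇔Q ]

toℕ-≡ᵇ-true⇔ : ∀ {m t} {j x : Fin m} → toℕ x ≡ t → (toℕ j ≡ᵇ t) ≡ true ⇔ j ≡ x
toℕ-≡ᵇ-true⇔ refl = mk⇔ (toℕ-injective ∘ Equivalence.to ≡ᵇ-true⇔) (Equivalence.from ≡ᵇ-true⇔ ∘ cong toℕ)

M-I-true⇔ : (i j : Fin (suc n)) → M-I (suc n) i j ≡ true ⇔ (j ≡ i ⊎ j ≡ next i)
M-I-true⇔ {n} i j with toℕ-next i
... | inj₁ (i≡n , i↦0)
  rewrite Equivalence.from ≡ᵇ-true⇔ i≡n | ∨-comm (toℕ j ≡ᵇ 0) (toℕ j ≡ᵇ n)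
  = ∨-true⇔ (toℕ-≡ᵇ-true⇔ i≡n) (toℕ-≡ᵇ-true⇔ (cong toℕ i↦0))
... | inj₂ (i<n , i↦) rewrite ≡ᵇ-false (<⇒≢ i<n)
  = ∨-true⇔ (toℕ-≡ᵇ-true⇔ refl) (toℕ-≡ᵇ-true⇔ i↦)

M-I* : ∀ n → Matrix (suc n) (suc (suc n))
M-I* n = star (M-I (suc n))

M-I*-true⇔ : (i : Fin (suc n)) (j : Fin (suc (suc n))) →
  M-I* n i j ≡ true ⇔ (j ≡ inject₁ i ⊎ j ≡ inject₁ (next i))
M-I*-true⇔ {n} i j with view j
... | ‵fromℕ rewrite star-fromℕ (M-I (suc n)) i =
  mk⇔ (λ ()) (⊥-elim ∘ [ fromℕ≢inject₁ , fromℕ≢inject₁ ])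
... | ‵inj₁ {i = j'} _ rewrite star-inject₁ (M-I (suc n)) i j' =
  mk⇔ (Sum.map (cong inject₁) (cong inject₁) ∘ Equivalence.to (M-I-true⇔ i j'))
      (Equivalence.from (M-I-true⇔ i j') ∘ Sum.map inject₁-injective inject₁-injective)

⊙-≡-not : ∀ {m k} (a : Seq m) (M : Matrix m k) i j → (a ⊙ M) i j ≡ not (a i) → M i j ≡ true
⊙-≡-not a M i j with a i | M i j
... | true  | true  = λ _ → refl
... | false | true  = λ _ → refl
... | true  | false = λ ()
... | false | false = λ ()

⊙-cancel : ∀ {m k} (a a' : Seq m) (M N : Matrix m k) i i' j j' →
  a i ≡ a' i' → (a ⊙ M) i j ≡ (a' ⊙ N) i' j' → M i j ≡ N i' j'
⊙-cancel a a' M N i i' j j' with a i | a' i'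
... | true  | true  = λ _ → not-injective
... | false | false = λ _ → id
... | true  | false = λ ()
... | false | true  = λ ()

surjective⇒≤ : ∀ {m k} (f : Fin m → Fin k) → (∀ j → ∃ λ i → f i ≡ j) → k ≤ m
surjective⇒≤ f surj = injective⇒≤ {f = proj₁ ∘ surj} λ {j} {j'} eq →
  trans (sym (proj₂ (surj j))) (trans (cong f eq) (proj₂ (surj j')))

AtMostTwo : ∀ {m} → (Fin m → Set) → Set
AtMostTwo P = ∃₂ λ x y → ∀ j → P j → j ≡ x ⊎ j ≡ y

AtMostTwo-preimage : ∀ {m m'} {P : Fin m → Set} {Q : Fin m' → Set} (f : Fin m → Fin m') (g : Fin m' → Fin m) →
  (∀ j → g (f j) ≡ j) → (∀ j → P j → Q (f j)) → AtMostTwo Q → AtMostTwo P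
AtMostTwo-preimage f g g∘f≡id P⇒Q (x , y , Q-at) =
  g x , g y , λ j Pj → Sum.map (back j) (back j) (Q-at (f j) (P⇒Q j Pj))
  where
  back : ∀ j {z} → f j ≡ z → j ≡ g z
  back j eq = trans (sym (g∘f≡id j)) (cong g eq)

atMostTwice⇒≤4 : ∀ {m} (r : Fin m → Bool) v →
  AtMostTwo (λ j → r j ≡ v) → AtMostTwo (λ j → r j ≡ not v) → m ≤ 4
atMostTwice⇒≤4 {m} r v (x , y , v-at) (x' , y' , not-v-at) = surjective⇒≤ place locate
  where
  place : Fin 4 → Fin m
  place zero                   = x
  place (suc zero)             = y
  place (suc (suc zero))       = x'
  place (suc (suc (suc zero))) = y'
  locate : ∀ j → ∃ λ q → place q ≡ j
  locate j with r j ≟ᴮ v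
  ... | yes rj≡v = [ (λ e → zero , sym e) , (λ e → suc zero , sym e) ]′ (v-at j rj≡v)
  ... | no  rj≢v = [ (λ e → suc (suc zero) , sym e) , (λ e → suc (suc (suc zero)) , sym e) ]′ (not-v-at j (¬-not rj≢v))

M-I*-row : (i : Fin (suc n)) → AtMostTwo (λ j → M-I* n i j ≡ true)
M-I*-row i = inject₁ i , inject₁ (next i) , λ j → Equivalence.to (M-I*-true⇔ i j)

edges-meet : {x y : Fin (suc n)} {z : Fin (suc (suc n))} → x ≢ y →
  z ≡ inject₁ x ⊎ z ≡ inject₁ (next x) → z ≡ inject₁ y ⊎ z ≡ inject₁ (next y) →
  y ≡ next x ⊎ x ≡ next y
edges-meet x≢y (inj₁ refl) (inj₁ eq) = contradiction (inject₁-injective eq) x≢y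
edges-meet x≢y (inj₁ refl) (inj₂ eq) = inj₂ (inject₁-injective eq)
edges-meet x≢y (inj₂ refl) (inj₁ eq) = inj₁ (sym (inject₁-injective eq))
edges-meet x≢y (inj₂ refl) (inj₂ eq) = contradiction (next-injective (inject₁-injective eq)) x≢y

module SameConfiguration
  {n} (3≤n : 3 ≤ n) {a a' : Seq (suc n)}
  (σ : Fin (suc n) ↔ Fin (suc n)) (τ : Fin (suc (suc n)) ↔ Fin (suc (suc n)))
  (same : ∀ i j → (a ⊙ M-I* n) (Inverse.to σ i) (Inverse.to τ j) ≡ (a' ⊙ M-I* n) i j)
  where

  s : Fin (suc n) → Fin (suc n)
  s = Inverse.to σ

  t : Fin (suc (suc n)) → Fin (suc (suc n))
  t = Inverse.to τ

  s-injective : Injective _≡_ _≡_ s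
  s-injective = Injection.injective (↔⇒↣ σ)

  -- If the bits of two matched rows differed, each value would occur at most twice in a row of length k + 1 ≥ 5.
  rows-agree : ∀ i → a (s i) ≡ a' i
  rows-agree i with a (s i) ≟ᴮ a' i
  ... | yes eq = eq
  ... | no  neq = contradiction (atMostTwice⇒≤4 ((a' ⊙ M-I* n) i) (a' i) a'-twice not-a'-twice) (ℕ.<⇒≱ (s≤s (s≤s 3≤n)))
    where
    not-a'-twice : AtMostTwo (λ j → (a' ⊙ M-I* n) i j ≡ not (a' i))
    not-a'-twice = AtMostTwo-preimage id id (λ _ → refl) (⊙-≡-not a' (M-I* n) i) (M-I*-row i)
    a'-twice : AtMostTwo (λ j → (a' ⊙ M-I* n) i j ≡ a' i)
    a'-twice = AtMostTwo-preimage t (Inverse.from τ) (Inverse.strictlyInverseʳ τ)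
      (λ j eq → ⊙-≡-not a (M-I* n) (s i) (t j) (trans (same i j) (trans eq (¬-not (neq ∘ sym)))))
      (M-I*-row (s i))

  M-I*-preserved : ∀ i j → M-I* n (s i) (t j) ≡ M-I* n i j
  M-I*-preserved i j = ⊙-cancel a a' (M-I* n) (M-I* n) (s i) i (t j) j (rows-agree i) (same i j)

  ones-preserved : ∀ i j → j ≡ inject₁ i ⊎ j ≡ inject₁ (next i) →
    t j ≡ inject₁ (s i) ⊎ t j ≡ inject₁ (next (s i))
  ones-preserved i j =
    Equivalence.to (M-I*-true⇔ (s i) (t j)) ∘ trans (M-I*-preserved i j) ∘ Equivalence.from (M-I*-true⇔ i j)

  adjacency-preserved : ∀ i → s (next i) ≡ next (s i) ⊎ s i ≡ next (s (next i))
  adjacency-preserved i = edges-meet (next-x≢x (≤-trans (s≤s z≤n) 3≤n) i ∘ sym ∘ s-injective)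
    (ones-preserved i (inject₁ (next i)) (inj₂ refl))
    (ones-preserved (next i) (inject₁ (next i)) (inj₁ refl))

lemma13 : (k : ℕ) → k ≥ 4 → (a a' : Seq k) →
    SameConfig (a ⊙ star (M-I k)) (a' ⊙ star (M-I k)) →
    UpToShiftRev a a'
lemma13 (suc n) (s≤s 3≤n) a a' (σ , τ , same) =
  [ (λ forward  → rotation⇒UpToShiftRev s forward rows-agree)
  , (λ backward → reflection⇒UpToShiftRev s backward rows-agree)
  ]′ (orientation (≤-trans (n≤1+n 2) 3≤n) s s-injective adjacency-preserved)
  where
  open SameConfiguration 3≤n {a} {a'} σ τ same
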